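{- For every term $t$ and all $k,l,k',l'\in\mathbb{N}$: (1) if $l'<l$, then $t\{k/l\}\{k'/l'\}=t\{k'/l'\}\{k/l+k'-1\}$; (2) if $l\le l'<l+k$, then $t\{k/l\}\{k'/l'\}=t\{k+k'-1/l\}$; (3) if $l+k\le l'$, then $t\{k/l\}\{k'/l'\}=t\{k'/l'-k+1\}\{k/l\}$.
   Context: Terms: $t::=x\mid\mathsf{box}\,t\mid\mathsf{unbox}_n\,t\mid\lambda x.t\mid s\ t$ with $n\in\mathbb{N}$; variables are names and terms are taken up to $\alpha$-renaming. The modal transformation $t\{k/l\}$ ($k,l\in\mathbb{N}$) is defined by: $x\{k/l\}=x$; $(\mathsf{box}\,t)\{k/l\}=\mathsf{box}(t\{k/l+1\})$; $(\mathsf{unbox}_n\,t)\{k/l\}=\mathsf{unbox}_n(t\{k/l-n\})$ if $n\le l$ and $=\mathsf{unbox}_{k+n-1}\,t$ if $n>l$; $(\lambda x.t)\{k/l\}=\lambda x.(t\{k/l\})$; $(s\ t)\{k/l\}=(s\{k/l\})\ (t\{k/l\})$. -}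

module Defs where

open import Data.Nat using (ℕ; _+_; _∸_; _≤?_)
open import Relation.Nullary using (yes; no)

-- Terms up to α-renaming, represented with de Bruijn indices
-- (variables are names; the modal transformation never touches them).
data Tm : Set where
  var   : ℕ → Tm
  box   : Tm → Tm
  unbox : ℕ → Tm → Tm
  lam   : Tm → Tm
  app   : Tm → Tm → Tm

_⟪_/_⟫ : Tm → ℕ → ℕ → Tm
var x     ⟪ k / l ⟫ = var x
box t     ⟪ k / l ⟫ = box (t ⟪ k / l + 1 ⟫)
unbox n t ⟪ k / l ⟫ with n ≤? l
... | yes _ = unbox n (t ⟪ k / l ∸ n ⟫)
... | no  _ = unbox (k + n ∸ 1) t
lam t     ⟪ k / l ⟫ = lam (t ⟪ k / l ⟫)
app s t   ⟪ k / l ⟫ = app (s ⟪ k / l ⟫) (t ⟪ k / l ⟫)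

{-# OPTIONS --safe #-}
module Submission where

-- Induction on t, where only unbox is interesting: its cases come from comparing the
-- index n with the levels of the two transformations. Part (3) is part (1) read from
-- right to left, with the two transformations exchanged.

open import Defs
open import Data.Nat using (ℕ; zero; suc; _+_; _∸_; _≤_; _<_; _≤?_; s≤s; s≤s⁻¹)
open import Data.Nat.Properties
open import Algebra.Properties.CommutativeSemigroup +-commutativeSemigroup
  using (x∙yz≈y∙xz; x∙yz≈yx∙z; xy∙z≈xz∙y)
open import Data.Product using (_×_; _,_)
open import Data.Sum using (_⊎_; inj₁; inj₂)
open import Relation.Binary.PropositionalEquality
open import Relation.Nullary using (yes; no)
open import Relation.Nullary.Negation using (contradiction)

≤⊎> : ∀ m n → m ≤ n ⊎ n < m
≤⊎> m n with m ≤? n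
... | yes m≤n = inj₁ m≤n
... | no  m≰n = inj₂ (≰⇒> m≰n)

unbox-⟪⟫-≤ : ∀ {n l} k t → n ≤ l → unbox n t ⟪ k / l ⟫ ≡ unbox n (t ⟪ k / l ∸ n ⟫)
unbox-⟪⟫-≤ {n} {l} k t n≤l with n ≤? l
... | yes _   = refl
... | no  n≰l = contradiction n≤l n≰l

unbox-⟪⟫-> : ∀ {n l} k t → l < n → unbox n t ⟪ k / l ⟫ ≡ unbox (k + n ∸ 1) t
unbox-⟪⟫-> {n} {l} k t l<n with n ≤? l
... | yes n≤l = contradiction n≤l (<⇒≱ l<n)
... | no  _   = refl

unbox-suc-⟪⟫ : ∀ {m l} k t → l ≤ m → unbox (suc m) t ⟪ k / l ⟫ ≡ unbox (k + m) t
unbox-suc-⟪⟫ {m} k t l≤m =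
  trans (unbox-⟪⟫-> k t (s≤s l≤m)) (cong (λ i → unbox (i ∸ 1) t) (+-suc k m))

⟪⟫-comm : ∀ t k k′ {l′ L} → l′ ≤ L →
  t ⟪ k / suc L ⟫ ⟪ k′ / l′ ⟫ ≡ t ⟪ k′ / l′ ⟫ ⟪ k / L + k′ ⟫
⟪⟫-comm (var x) k k′ l′≤L = refl
⟪⟫-comm (box t) k k′ {l′} {L} l′≤L =
  cong box (trans (⟪⟫-comm t k k′ (+-monoˡ-≤ 1 l′≤L))
                  (cong (λ i → t ⟪ k′ / l′ + 1 ⟫ ⟪ k / i ⟫) (xy∙z≈xz∙y L 1 k′)))
⟪⟫-comm (unbox n t) k k′ {l′} {L} l′≤L with ≤⊎> n l′ | ≤⊎> n (suc L)
... | inj₁ n≤l′ | _ = begin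
    unbox n t ⟪ k / suc L ⟫ ⟪ k′ / l′ ⟫
  ≡⟨ cong (_⟪ k′ / l′ ⟫) (unbox-⟪⟫-≤ k t (m≤n⇒m≤1+n n≤L)) ⟩
    unbox n (t ⟪ k / suc L ∸ n ⟫) ⟪ k′ / l′ ⟫
  ≡⟨ unbox-⟪⟫-≤ k′ _ n≤l′ ⟩
    unbox n (t ⟪ k / suc L ∸ n ⟫ ⟪ k′ / l′ ∸ n ⟫)
  ≡⟨ cong (λ i → unbox n (t ⟪ k / i ⟫ ⟪ k′ / l′ ∸ n ⟫)) (+-∸-assoc 1 n≤L) ⟩
    unbox n (t ⟪ k / suc (L ∸ n) ⟫ ⟪ k′ / l′ ∸ n ⟫)
  ≡⟨ cong (unbox n) (⟪⟫-comm t k k′ (∸-monoˡ-≤ n l′≤L)) ⟩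
    unbox n (t ⟪ k′ / l′ ∸ n ⟫ ⟪ k / L ∸ n + k′ ⟫)
  ≡⟨ cong (λ i → unbox n (t ⟪ k′ / l′ ∸ n ⟫ ⟪ k / i ⟫)) (+-∸-comm k′ n≤L) ⟨
    unbox n (t ⟪ k′ / l′ ∸ n ⟫ ⟪ k / L + k′ ∸ n ⟫)
  ≡⟨ unbox-⟪⟫-≤ k _ (m≤n⇒m≤n+o k′ n≤L) ⟨
    unbox n (t ⟪ k′ / l′ ∸ n ⟫) ⟪ k / L + k′ ⟫
  ≡⟨ cong (_⟪ k / L + k′ ⟫) (unbox-⟪⟫-≤ k′ t n≤l′) ⟨
    unbox n t ⟪ k′ / l′ ⟫ ⟪ k / L + k′ ⟫
  ∎
  where
  open ≡-Reasoning
  n≤L : n ≤ L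
  n≤L = ≤-trans n≤l′ l′≤L
... | inj₂ (s≤s {n = m} l′≤m) | inj₁ (s≤s m≤L) = begin
    unbox (suc m) t ⟪ k / suc L ⟫ ⟪ k′ / l′ ⟫
  ≡⟨ cong (_⟪ k′ / l′ ⟫) (unbox-⟪⟫-≤ k t (s≤s m≤L)) ⟩
    unbox (suc m) (t ⟪ k / L ∸ m ⟫) ⟪ k′ / l′ ⟫
  ≡⟨ unbox-suc-⟪⟫ k′ _ l′≤m ⟩
    unbox (k′ + m) (t ⟪ k / L ∸ m ⟫)
  ≡⟨ cong (λ i → unbox (k′ + m) (t ⟪ k / i ⟫)) L+k′∸[k′+m]≡L∸m ⟨
    unbox (k′ + m) (t ⟪ k / L + k′ ∸ (k′ + m) ⟫)
  ≡⟨ unbox-⟪⟫-≤ k t (subst (k′ + m ≤_) (+-comm k′ L) (+-monoʳ-≤ k′ m≤L)) ⟨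
    unbox (k′ + m) t ⟪ k / L + k′ ⟫
  ≡⟨ cong (_⟪ k / L + k′ ⟫) (unbox-suc-⟪⟫ k′ t l′≤m) ⟨
    unbox (suc m) t ⟪ k′ / l′ ⟫ ⟪ k / L + k′ ⟫
  ∎
  where
  open ≡-Reasoning
  L+k′∸[k′+m]≡L∸m : L + k′ ∸ (k′ + m) ≡ L ∸ m
  L+k′∸[k′+m]≡L∸m = trans (cong (_∸ (k′ + m)) (+-comm L k′)) ([m+n]∸[m+o]≡n∸o k′ L m)
... | inj₂ (s≤s {n = m} l′≤m) | inj₂ (s≤s L<m) = begin
    unbox (suc m) t ⟪ k / suc L ⟫ ⟪ k′ / l′ ⟫
  ≡⟨ cong (_⟪ k′ / l′ ⟫) (unbox-suc-⟪⟫ k t L<m) ⟩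
    unbox (k + m) t ⟪ k′ / l′ ⟫
  ≡⟨ unbox-⟪⟫-> k′ t (≤-trans (s≤s l′≤L) (≤-trans L<m (m≤n+m m k))) ⟩
    unbox (k′ + (k + m) ∸ 1) t
  ≡⟨ cong (λ i → unbox (i ∸ 1) t) (x∙yz≈y∙xz k′ k m) ⟩
    unbox (k + (k′ + m) ∸ 1) t
  ≡⟨ unbox-⟪⟫-> k t (subst (_< k′ + m) (+-comm k′ L) (+-monoʳ-< k′ L<m)) ⟨
    unbox (k′ + m) t ⟪ k / L + k′ ⟫
  ≡⟨ cong (_⟪ k / L + k′ ⟫) (unbox-suc-⟪⟫ k′ t l′≤m) ⟨
    unbox (suc m) t ⟪ k′ / l′ ⟫ ⟪ k / L + k′ ⟫
  ∎
  where open ≡-Reasoning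
⟪⟫-comm (lam t)   k k′ l′≤L = cong lam (⟪⟫-comm t k k′ l′≤L)
⟪⟫-comm (app s t) k k′ l′≤L = cong₂ app (⟪⟫-comm s k k′ l′≤L) (⟪⟫-comm t k k′ l′≤L)

⟪⟫-fuse : ∀ t K k′ {l l′} → l ≤ l′ → l′ ≤ l + K →
  t ⟪ suc K / l ⟫ ⟪ k′ / l′ ⟫ ≡ t ⟪ K + k′ / l ⟫
⟪⟫-fuse (var x) K k′ l≤l′ l′≤l+K = refl
⟪⟫-fuse (box t) K k′ {l} {l′} l≤l′ l′≤l+K =
  cong box (⟪⟫-fuse t K k′ (+-monoˡ-≤ 1 l≤l′)
                     (subst (l′ + 1 ≤_) (xy∙z≈xz∙y l K 1) (+-monoˡ-≤ 1 l′≤l+K)))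
⟪⟫-fuse (unbox n t) K k′ {l} {l′} l≤l′ l′≤l+K with ≤⊎> n l
... | inj₁ n≤l = begin
    unbox n t ⟪ suc K / l ⟫ ⟪ k′ / l′ ⟫
  ≡⟨ cong (_⟪ k′ / l′ ⟫) (unbox-⟪⟫-≤ (suc K) t n≤l) ⟩
    unbox n (t ⟪ suc K / l ∸ n ⟫) ⟪ k′ / l′ ⟫
  ≡⟨ unbox-⟪⟫-≤ k′ _ (≤-trans n≤l l≤l′) ⟩
    unbox n (t ⟪ suc K / l ∸ n ⟫ ⟪ k′ / l′ ∸ n ⟫)
  ≡⟨ cong (unbox n) (⟪⟫-fuse t K k′ (∸-monoˡ-≤ n l≤l′)
       (subst (l′ ∸ n ≤_) (+-∸-comm K n≤l) (∸-monoˡ-≤ n l′≤l+K))) ⟩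
    unbox n (t ⟪ K + k′ / l ∸ n ⟫)
  ≡⟨ unbox-⟪⟫-≤ (K + k′) t n≤l ⟨
    unbox n t ⟪ K + k′ / l ⟫
  ∎
  where open ≡-Reasoning
... | inj₂ (s≤s {n = m} l≤m) = begin
    unbox (suc m) t ⟪ suc K / l ⟫ ⟪ k′ / l′ ⟫
  ≡⟨ cong (_⟪ k′ / l′ ⟫) (unbox-suc-⟪⟫ (suc K) t l≤m) ⟩
    unbox (suc (K + m)) t ⟪ k′ / l′ ⟫
  ≡⟨ unbox-suc-⟪⟫ k′ t (≤-trans l′≤l+K (subst (l + K ≤_) (+-comm m K) (+-monoˡ-≤ K l≤m))) ⟩
    unbox (k′ + (K + m)) t
  ≡⟨ cong (λ i → unbox i t) (x∙yz≈yx∙z k′ K m) ⟩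
    unbox (K + k′ + m) t
  ≡⟨ unbox-suc-⟪⟫ (K + k′) t l≤m ⟨
    unbox (suc m) t ⟪ K + k′ / l ⟫
  ∎
  where open ≡-Reasoning
⟪⟫-fuse (lam t)   K k′ l≤l′ l′≤l+K = cong lam (⟪⟫-fuse t K k′ l≤l′ l′≤l+K)
⟪⟫-fuse (app s t) K k′ l≤l′ l′≤l+K =
  cong₂ app (⟪⟫-fuse s K k′ l≤l′ l′≤l+K) (⟪⟫-fuse t K k′ l≤l′ l′≤l+K)

lemma2p3 : (t : Tm) (k l k′ l′ : ℕ) →
  (l′ < l → t ⟪ k / l ⟫ ⟪ k′ / l′ ⟫ ≡ t ⟪ k′ / l′ ⟫ ⟪ k / l + k′ ∸ 1 ⟫)
  × (l ≤ l′ → l′ < l + k → t ⟪ k / l ⟫ ⟪ k′ / l′ ⟫ ≡ t ⟪ k + k′ ∸ 1 / l ⟫)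
  × (l + k ≤ l′ → t ⟪ k / l ⟫ ⟪ k′ / l′ ⟫ ≡ t ⟪ k′ / l′ ∸ k + 1 ⟫ ⟪ k / l ⟫)
lemma2p3 t k l k′ l′ = below , inside k , above
  where
  below : l′ < l → t ⟪ k / l ⟫ ⟪ k′ / l′ ⟫ ≡ t ⟪ k′ / l′ ⟫ ⟪ k / l + k′ ∸ 1 ⟫
  below (s≤s l′≤L) = ⟪⟫-comm t k k′ l′≤L

  inside : ∀ j → l ≤ l′ → l′ < l + j → t ⟪ j / l ⟫ ⟪ k′ / l′ ⟫ ≡ t ⟪ j + k′ ∸ 1 / l ⟫
  inside zero    l≤l′ l′<l+0 = contradiction (subst (l′ <_) (+-identityʳ l) l′<l+0) (≤⇒≯ l≤l′)
  inside (suc K) l≤l′ l′<l+1+K = ⟪⟫-fuse t K k′ l≤l′ (s≤s⁻¹ (subst (l′ <_) (+-suc l K) l′<l+1+K))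

  above : l + k ≤ l′ → t ⟪ k / l ⟫ ⟪ k′ / l′ ⟫ ≡ t ⟪ k′ / l′ ∸ k + 1 ⟫ ⟪ k / l ⟫
  above l+k≤l′ = begin
      t ⟪ k / l ⟫ ⟪ k′ / l′ ⟫
    ≡⟨ cong (λ i → t ⟪ k / l ⟫ ⟪ k′ / i ⟫) (m∸n+n≡m (m+n≤o⇒n≤o l l+k≤l′)) ⟨
      t ⟪ k / l ⟫ ⟪ k′ / l′ ∸ k + k ⟫
    ≡⟨ ⟪⟫-comm t k′ k (m+n≤o⇒m≤o∸n l l+k≤l′) ⟨
      t ⟪ k′ / suc (l′ ∸ k) ⟫ ⟪ k / l ⟫
    ≡⟨ cong (λ i → t ⟪ k′ / i ⟫ ⟪ k / l ⟫) (+-comm 1 (l′ ∸ k)) ⟩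
      t ⟪ k′ / l′ ∸ k + 1 ⟫ ⟪ k / l ⟫
    ∎
    where open ≡-Reasoning
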